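{- Let $G$ be a graph on $[n]$ with $\langle G\rangle_{K_4} = K_n$, and let $1 \leqslant L \leqslant n$. Then there exists a clique $K \subset K_n$ which is internally spanned by $G$ and satisfies $L \leqslant v(K) \leqslant 3L$.
   Context: The $K_4$-bootstrap process on a graph repeatedly adds any non-edge which is the only missing edge of some copy of $K_4$; $\langle G\rangle_{K_4}$ denotes the final graph. A clique $K$ on vertex set $S \subset [n]$ is internally spanned by $G$ if the $K_4$-closure of the subgraph of $G$ induced on $S$ (process run on vertex set $S$) is the complete graph on $S$. -}

module Defs where

open import Data.Nat using (ℕ)
open import Data.Fin using (Fin)
open import Data.Fin.Subset using (Subset; _∈_; ⊤)
open import Relation.Binary.PropositionalEquality using (_≡_; _≢_)
open import Relation.Nullary using (¬_)

record Graph (n : ℕ) : Set₁ where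
  field
    Adj     : Fin n → Fin n → Set
    sym     : ∀ {u v} → Adj u v → Adj v u
    irrefl  : ∀ {u} → ¬ Adj u u
open Graph public

-- Edges of the K₄-closure of G[S], the K₄-bootstrap process run on vertex
-- set S starting from the induced subgraph G[S].  The final graph of the
-- (monotone) process is the least set of edges containing G[S] and closed
-- under adding a pair uv whenever there are x, y ∈ S with u, v, x, y
-- distinct and ux, uy, vx, vy, xy all already present.
data Closure {n : ℕ} (G : Graph n) (S : Subset n) : Fin n → Fin n → Set where
  base : ∀ {u v} → u ∈ S → v ∈ S → Adj G u v → Closure G S u v
  step : ∀ {u v} (x y : Fin n) → u ∈ S → v ∈ S → x ∈ S → y ∈ S →
         u ≢ v → u ≢ x → u ≢ y → v ≢ x → v ≢ y → x ≢ y →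
         Closure G S u x → Closure G S u y →
         Closure G S v x → Closure G S v y →
         Closure G S x y → Closure G S u v

InternallySpanned : {n : ℕ} → Graph n → Subset n → Set
InternallySpanned G S = ∀ u v → u ∈ S → v ∈ S → u ≢ v → Closure G S u v

SpansKn : {n : ℕ} → Graph n → Set
SpansKn G = InternallySpanned G ⊤

-- The argument glues internally spanned sets together.  Everything rests on
-- one observation, the K₄-completion lemma: if x ≠ y are joined in the
-- closure of G[S] and p, q are each joined (or equal) to both x and y, then p
-- and q are joined as well.  Hence a set is internally spanned as soon as it
-- has a spanned "hub" edge xy to which every vertex is joined, and this gives
-- two gluing rules: spanned sets sharing two vertices have a spanned union,
-- and three spanned sets covering the sides of a triangle uxy do too.
--
-- Call a spanned set small if it has fewer than L vertices.  By induction on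
-- closure derivations, every closure edge uv lies in a small spanned set, or
-- else gluing at most three small sets already produces a spanned set of size
-- in [L, 3L].  Finally, starting from a small spanned set containing two
-- vertices a₁, a₂, pick w outside it, glue the small sets covering wa₁ and wa₂
-- onto it, and repeat; the set grows at each step, so it eventually reaches
-- size L, while a single step never exceeds 3L.
module Submission where

open import Defs
open import Data.Nat using (ℕ; zero; suc; _≤_; _<_; _+_; _*_; z≤n; s≤s)
open import Data.Nat.Properties
  using (≤-trans; <-≤-trans; ≤-refl; ≤-reflexive; <⇒≤; +-mono-≤; +-monoʳ-≤; +-suc; +-identityʳ; m≤m+n; m≤n+m; n≤1+n; <-irrefl; _≤?_; ≰⇒>)
open import Data.Fin using (Fin; _≟_) renaming (zero to fzero; suc to fsuc)
open import Data.Fin.Subset using (Subset; ∣_∣; _∈_; _∉_; _∪_; ⁅_⁆; _⊆_; _⊂_; inside; outside)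
open import Data.Fin.Subset.Properties
  using (p⊆p∪q; q⊆p∪q; x∈p∪q⁻; x∈p∪q⁺; x∈⁅x⁆; x∈⁅y⁆⇒x≡y; ∣⁅x⁆∣≡1; p⊂q⇒∣p∣<∣q∣; ∈⊤)
open import Data.Vec using (_∷_; []; _[_]=_)
open _[_]=_
open import Data.Product using (Σ; _×_; _,_; proj₁; proj₂)
open import Data.Sum using (_⊎_; inj₁; inj₂)
open import Data.Empty using (⊥-elim)
open import Relation.Nullary using (¬_; yes; no)
open import Relation.Binary.PropositionalEquality using (_≡_; _≢_; refl; subst; trans; cong₂) renaming (sym to ≡-sym)

∣p∪q∣≤∣p∣+∣q∣ : ∀ {n} (p q : Subset n) → ∣ p ∪ q ∣ ≤ ∣ p ∣ + ∣ q ∣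
∣p∪q∣≤∣p∣+∣q∣ []            []            = z≤n
∣p∪q∣≤∣p∣+∣q∣ (outside ∷ p) (outside ∷ q) = ∣p∪q∣≤∣p∣+∣q∣ p q
∣p∪q∣≤∣p∣+∣q∣ (outside ∷ p) (inside  ∷ q) =
  subst (suc ∣ p ∪ q ∣ ≤_) (≡-sym (+-suc ∣ p ∣ ∣ q ∣)) (s≤s (∣p∪q∣≤∣p∣+∣q∣ p q))
∣p∪q∣≤∣p∣+∣q∣ (inside  ∷ p) (outside ∷ q) = s≤s (∣p∪q∣≤∣p∣+∣q∣ p q)
∣p∪q∣≤∣p∣+∣q∣ (inside  ∷ p) (inside  ∷ q) =
  s≤s (≤-trans (∣p∪q∣≤∣p∣+∣q∣ p q) (subst (∣ p ∣ + ∣ q ∣ ≤_) (≡-sym (+-suc ∣ p ∣ ∣ q ∣)) (n≤1+n _)))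

R⊆P∪Q∪R : ∀ {n} (P Q : Subset n) {R : Subset n} → R ⊆ P ∪ Q ∪ R
R⊆P∪Q∪R P Q {R} z = q⊆p∪q P (Q ∪ R) (q⊆p∪q Q R z)

missing-vertex : ∀ {n} (p : Subset n) → ∣ p ∣ < n → Σ (Fin n) (λ w → w ∉ p)
missing-vertex (outside ∷ p) _ = fzero , λ ()
missing-vertex (inside ∷ p) (s≤s ∣p∣<n) with missing-vertex p ∣p∣<n
... | w , w∉p = fsuc w , λ { (there w∈p) → w∉p w∈p }

pair-member : ∀ {n} {u v p : Fin n} → p ∈ ⁅ u ⁆ ∪ ⁅ v ⁆ → p ≡ u ⊎ p ≡ v
pair-member {u = u} {v} p∈ with x∈p∪q⁻ ⁅ u ⁆ ⁅ v ⁆ p∈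
... | inj₁ p∈u = inj₁ (x∈⁅y⁆⇒x≡y u p∈u)
... | inj₂ p∈v = inj₂ (x∈⁅y⁆⇒x≡y v p∈v)

∈-∉-distinct : ∀ {n} {a b : Fin n} {S : Subset n} → a ∈ S → b ∉ S → b ≢ a
∈-∉-distinct a∈S b∉S refl = b∉S a∈S

module _ {n : ℕ} (G : Graph n) where

  private
    C : Subset n → Fin n → Fin n → Set
    C = Closure G

    Spanned : Subset n → Set
    Spanned = InternallySpanned G

  Closure-ends : ∀ {S u v} → C S u v → u ∈ S × v ∈ S
  Closure-ends (base u∈S v∈S _)                             = u∈S , v∈S
  Closure-ends (step _ _ u∈S v∈S _ _ _ _ _ _ _ _ _ _ _ _ _) = u∈S , v∈S

  Closure-irrefl : ∀ {S u} → ¬ C S u u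
  Closure-irrefl (base _ _ e)                             = irrefl G e
  Closure-irrefl (step _ _ _ _ _ _ u≢u _ _ _ _ _ _ _ _ _ _) = u≢u refl

  Closure-sym : ∀ {S u v} → C S u v → C S v u
  Closure-sym (base u∈S v∈S e) = base v∈S u∈S (Graph.sym G e)
  Closure-sym (step x y u∈S v∈S x∈S y∈S u≢v u≢x u≢y v≢x v≢y x≢y ux uy vx vy xy) =
    step x y v∈S u∈S x∈S y∈S (λ v≡u → u≢v (≡-sym v≡u)) v≢x v≢y u≢x u≢y x≢y vx vy ux uy xy

  Closure-mono : ∀ {S T u v} → S ⊆ T → C S u v → C T u v
  Closure-mono S⊆T (base u∈S v∈S e) = base (S⊆T u∈S) (S⊆T v∈S) e
  Closure-mono S⊆T (step x y u∈S v∈S x∈S y∈S u≢v u≢x u≢y v≢x v≢y x≢y ux uy vx vy xy) =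
    step x y (S⊆T u∈S) (S⊆T v∈S) (S⊆T x∈S) (S⊆T y∈S) u≢v u≢x u≢y v≢x v≢y x≢y
      (Closure-mono S⊆T ux) (Closure-mono S⊆T uy) (Closure-mono S⊆T vx)
      (Closure-mono S⊆T vy) (Closure-mono S⊆T xy)

  Linked : Subset n → Fin n → Fin n → Set
  Linked S p q = p ≡ q ⊎ C S p q

  Linked-sym : ∀ {S p q} → Linked S p q → Linked S q p
  Linked-sym (inj₁ p≡q) = inj₁ (≡-sym p≡q)
  Linked-sym (inj₂ pq)  = inj₂ (Closure-sym pq)

  Linked-mono : ∀ {S T p q} → S ⊆ T → Linked S p q → Linked T p q
  Linked-mono S⊆T (inj₁ p≡q) = inj₁ p≡q
  Linked-mono S⊆T (inj₂ pq)  = inj₂ (Closure-mono S⊆T pq)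

  Linked⇒Closure : ∀ {S p q} → p ≢ q → Linked S p q → C S p q
  Linked⇒Closure p≢q (inj₁ p≡q) = ⊥-elim (p≢q p≡q)
  Linked⇒Closure p≢q (inj₂ pq)  = pq

  spanned-linked : ∀ {S p q} → Spanned S → p ∈ S → q ∈ S → Linked S p q
  spanned-linked {p = p} {q} spanned p∈S q∈S with p ≟ q
  ... | yes p≡q = inj₁ p≡q
  ... | no  p≢q = inj₂ (spanned p q p∈S q∈S p≢q)

  -- K₄-completion: two vertices linked to both ends of a closure edge xy are
  -- linked.  When all four are distinct this is one step of the process.
  K₄-completion : ∀ {S x y p q} → C S x y →
    Linked S p x → Linked S p y → Linked S q x → Linked S q y → Linked S p q
  K₄-completion _ (inj₁ refl) _ qx _ = Linked-sym qx
  K₄-completion _ _ (inj₁ refl) _ qy = Linked-sym qy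
  K₄-completion _ px _ (inj₁ refl) _ = px
  K₄-completion _ _ py _ (inj₁ refl) = py
  K₄-completion {x = x} {y} {p} {q} xy (inj₂ px) (inj₂ py) (inj₂ qx) (inj₂ qy) with p ≟ q
  ... | yes p≡q = inj₁ p≡q
  ... | no  p≢q =
    inj₂ (step x y (proj₁ (Closure-ends px)) (proj₁ (Closure-ends qx))
               (proj₁ (Closure-ends xy)) (proj₂ (Closure-ends xy))
               p≢q (distinct px) (distinct py) (distinct qx) (distinct qy) (distinct xy)
               px py qx qy xy)
    where
    distinct : ∀ {a b} → C _ a b → a ≢ b
    distinct ab refl = Closure-irrefl ab

  spanned-by-hub : ∀ {T x y} → C T x y →
    (∀ {p} → p ∈ T → Linked T p x × Linked T p y) → Spanned T
  spanned-by-hub xy hub p q p∈T q∈T p≢q =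
    Linked⇒Closure p≢q
      (K₄-completion xy (proj₁ (hub p∈T)) (proj₂ (hub p∈T)) (proj₁ (hub q∈T)) (proj₂ (hub q∈T)))

  glue-along-edge : ∀ {A B x y} → Spanned A → Spanned B →
    x ∈ A → x ∈ B → y ∈ A → y ∈ B → x ≢ y → Spanned (A ∪ B)
  glue-along-edge {A} {B} {x} {y} spA spB x∈A x∈B y∈A y∈B x≢y =
    spanned-by-hub (Closure-mono A⊆ (spA x y x∈A y∈A x≢y)) hub
    where
    A⊆ : A ⊆ A ∪ B
    A⊆ = p⊆p∪q B
    B⊆ : B ⊆ A ∪ B
    B⊆ = q⊆p∪q A B
    hub : ∀ {p} → p ∈ A ∪ B → Linked (A ∪ B) p x × Linked (A ∪ B) p y
    hub p∈ with x∈p∪q⁻ A B p∈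
    ... | inj₁ p∈A = Linked-mono A⊆ (spanned-linked spA p∈A x∈A) , Linked-mono A⊆ (spanned-linked spA p∈A y∈A)
    ... | inj₂ p∈B = Linked-mono B⊆ (spanned-linked spB p∈B x∈B) , Linked-mono B⊆ (spanned-linked spB p∈B y∈B)

  glue-triangle : ∀ {A₁ A₂ A₃ u x y} → Spanned A₁ → Spanned A₂ → Spanned A₃ →
    u ∈ A₁ → x ∈ A₁ → u ∈ A₂ → y ∈ A₂ → x ∈ A₃ → y ∈ A₃ →
    u ≢ x → u ≢ y → x ≢ y → Spanned (A₁ ∪ A₂ ∪ A₃)
  glue-triangle {A₁} {A₂} {A₃} {u} {x} {y} sp₁ sp₂ sp₃ u₁ x₁ u₂ y₂ x₃ y₃ u≢x u≢y x≢y =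
    spanned-by-hub xy hub
    where
    T = A₁ ∪ A₂ ∪ A₃
    A₁⊆ : A₁ ⊆ T
    A₁⊆ = p⊆p∪q (A₂ ∪ A₃)
    A₂⊆ : A₂ ⊆ T
    A₂⊆ z = q⊆p∪q A₁ (A₂ ∪ A₃) (p⊆p∪q A₃ z)
    A₃⊆ : A₃ ⊆ T
    A₃⊆ = R⊆P∪Q∪R A₁ A₂
    ux : C T u x
    ux = Closure-mono A₁⊆ (sp₁ u x u₁ x₁ u≢x)
    uy : C T u y
    uy = Closure-mono A₂⊆ (sp₂ u y u₂ y₂ u≢y)
    xy : C T x y
    xy = Closure-mono A₃⊆ (sp₃ x y x₃ y₃ x≢y)
    linked : ∀ {A} → A ⊆ T → Spanned A → ∀ {p q} → p ∈ A → q ∈ A → Linked T p q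
    linked A⊆ spA p∈A q∈A = Linked-mono A⊆ (spanned-linked spA p∈A q∈A)
    hub : ∀ {p} → p ∈ T → Linked T p x × Linked T p y
    hub p∈T with x∈p∪q⁻ A₁ (A₂ ∪ A₃) p∈T
    ... | inj₁ p₁ = px , K₄-completion ux (linked A₁⊆ sp₁ p₁ u₁) px (inj₂ (Closure-sym uy)) (inj₂ (Closure-sym xy))
      where px = linked A₁⊆ sp₁ p₁ x₁
    ... | inj₂ p∈ with x∈p∪q⁻ A₂ A₃ p∈
    ... | inj₁ p₂ = K₄-completion uy (linked A₂⊆ sp₂ p₂ u₂) py (inj₂ (Closure-sym ux)) (inj₂ xy) , py
      where py = linked A₂⊆ sp₂ p₂ y₂
    ... | inj₂ p₃ = linked A₃⊆ sp₃ p₃ x₃ , linked A₃⊆ sp₃ p₃ y₃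

  singleton-spanned : ∀ {u} → Spanned ⁅ u ⁆
  singleton-spanned {u} p q p∈ q∈ p≢q =
    ⊥-elim (p≢q (trans (x∈⁅y⁆⇒x≡y u p∈) (≡-sym (x∈⁅y⁆⇒x≡y u q∈))))

  edge-spanned : ∀ {u v} → Adj G u v → Spanned (⁅ u ⁆ ∪ ⁅ v ⁆)
  edge-spanned e p q p∈ q∈ p≢q with pair-member p∈ | pair-member q∈
  ... | inj₁ refl | inj₁ refl = ⊥-elim (p≢q refl)
  ... | inj₁ refl | inj₂ refl = base p∈ q∈ e
  ... | inj₂ refl | inj₁ refl = base p∈ q∈ (Graph.sym G e)
  ... | inj₂ refl | inj₂ refl = ⊥-elim (p≢q refl)

  module Window (L : ℕ) (1≤L : 1 ≤ L) where

    Good : Subset n → Set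
    Good S = Spanned S × (L ≤ ∣ S ∣ × ∣ S ∣ ≤ 3 * L)

    Found : Set
    Found = Σ (Subset n) Good

    -- Spanned sets too small to be good; three of them glue to at most 3L vertices.
    Small : Subset n → Set
    Small S = Spanned S × ∣ S ∣ < L

    _>>=_ : ∀ {P Q : Set} → Found ⊎ P → (P → Found ⊎ Q) → Found ⊎ Q
    inj₁ found >>= _ = inj₁ found
    inj₂ p     >>= f = f p

    classify : ∀ {S} → Spanned S → ∣ S ∣ ≤ 3 * L → Found ⊎ Small S
    classify {S} spS ∣S∣≤3L with L ≤? ∣ S ∣
    ... | yes L≤∣S∣ = inj₁ (S , spS , L≤∣S∣ , ∣S∣≤3L)
    ... | no  L≰∣S∣ = inj₂ (spS , ≰⇒> L≰∣S∣)

    -- Size bounds for unions of at most three small sets or for an edge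
    -- (3 * L unfolds to L + (L + (L + 0))).
    two-small : ∀ {A B} → Small A → Small B → ∣ A ∪ B ∣ ≤ 3 * L
    two-small {A} {B} (_ , a<L) (_ , b<L) =
      ≤-trans (∣p∪q∣≤∣p∣+∣q∣ A B) (+-mono-≤ (<⇒≤ a<L) (≤-trans (<⇒≤ b<L) (m≤m+n L (L + 0))))

    three-small : ∀ {A B D} → Small A → Small B → Small D → ∣ A ∪ B ∪ D ∣ ≤ 3 * L
    three-small {A} {B} {D} (_ , a<L) (_ , b<L) (_ , d<L) =
      ≤-trans (∣p∪q∣≤∣p∣+∣q∣ A (B ∪ D)) (≤-trans (+-monoʳ-≤ ∣ A ∣ (∣p∪q∣≤∣p∣+∣q∣ B D))
        (+-mono-≤ (<⇒≤ a<L) (+-mono-≤ (<⇒≤ b<L) (≤-trans (<⇒≤ d<L) (≤-reflexive (≡-sym (+-identityʳ L)))))))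

    pair-bound : ∀ (u v : Fin n) → ∣ ⁅ u ⁆ ∪ ⁅ v ⁆ ∣ ≤ 3 * L
    pair-bound u v =
      ≤-trans (∣p∪q∣≤∣p∣+∣q∣ ⁅ u ⁆ ⁅ v ⁆)
        (subst (_≤ 3 * L) (≡-sym (cong₂ _+_ (∣⁅x⁆∣≡1 u) (∣⁅x⁆∣≡1 v)))
          (+-mono-≤ 1≤L (≤-trans 1≤L (m≤m+n L (L + 0)))))

    glue-small-triangle : ∀ {A₁ A₂ A₃ u x y} → Small A₁ → Small A₂ → Small A₃ →
      u ∈ A₁ → x ∈ A₁ → u ∈ A₂ → y ∈ A₂ → x ∈ A₃ → y ∈ A₃ →
      u ≢ x → u ≢ y → x ≢ y → Found ⊎ Small (A₁ ∪ A₂ ∪ A₃)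
    glue-small-triangle s₁ s₂ s₃ u₁ x₁ u₂ y₂ x₃ y₃ u≢x u≢y x≢y =
      classify (glue-triangle (proj₁ s₁) (proj₁ s₂) (proj₁ s₃) u₁ x₁ u₂ y₂ x₃ y₃ u≢x u≢y x≢y)
               (three-small s₁ s₂ s₃)

    Cover : Fin n → Fin n → Set
    Cover u v = Σ (Subset n) (λ A → Small A × u ∈ A × v ∈ A)

    -- For a step adding uv via x, y: glue covers of ux, uy, xy into U and of
    -- vx, vy, xy into V; then U and V share x, y, so U ∪ V covers uv.
    cover : ∀ {S u v} → C S u v → Found ⊎ Cover u v
    cover {u = u} {v} (base _ _ e) = do
      small ← classify (edge-spanned e) (pair-bound u v)
      inj₂ (⁅ u ⁆ ∪ ⁅ v ⁆ , small , x∈p∪q⁺ (inj₁ (x∈⁅x⁆ u)) , x∈p∪q⁺ (inj₂ (x∈⁅x⁆ v)))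
    cover (step x y _ _ _ _ _ u≢x u≢y v≢x v≢y x≢y ux uy vx vy xy) = do
      (A₁ , s₁ , u₁ , x₁) ← cover ux
      (A₂ , s₂ , u₂ , y₂) ← cover uy
      (A₃ , s₃ , x₃ , y₃) ← cover xy
      (B₁ , t₁ , v₁ , x₁′) ← cover vx
      (B₂ , t₂ , v₂ , y₂′) ← cover vy
      smallU ← glue-small-triangle s₁ s₂ s₃ u₁ x₁ u₂ y₂ x₃ y₃ u≢x u≢y x≢y
      smallV ← glue-small-triangle t₁ t₂ s₃ v₁ x₁′ v₂ y₂′ x₃ y₃ v≢x v≢y x≢y
      let U = A₁ ∪ A₂ ∪ A₃
          V = B₁ ∪ B₂ ∪ A₃
      smallW ← classify
        (glue-along-edge (proj₁ smallU) (proj₁ smallV)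
          (R⊆P∪Q∪R A₁ A₂ x₃) (R⊆P∪Q∪R B₁ B₂ x₃) (R⊆P∪Q∪R A₁ A₂ y₃) (R⊆P∪Q∪R B₁ B₂ y₃) x≢y)
        (two-small smallU smallV)
      inj₂ (U ∪ V , smallW , p⊆p∪q V (p⊆p∪q (A₂ ∪ A₃) u₁) , q⊆p∪q U V (p⊆p∪q (B₂ ∪ A₃) v₁))

    module _ (spans : SpansKn G) (L≤n : L ≤ n) where

      -- Glue the
      -- covers of wa₁ and wa₂, for some w outside A, onto A.
      extend : ∀ {A a₁ a₂} → Small A → a₁ ∈ A → a₂ ∈ A → a₁ ≢ a₂ →
        Found ⊎ Σ (Subset n) (λ B → Small B × A ⊂ B)
      extend {A} {a₁} {a₂} smallA a₁∈A a₂∈A a₁≢a₂ = do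
        let (w , w∉A) = missing-vertex A (<-≤-trans (proj₂ smallA) L≤n)
            w≢a₁ = ∈-∉-distinct a₁∈A w∉A
            w≢a₂ = ∈-∉-distinct a₂∈A w∉A
        (B₁ , s₁ , w₁ , a₁′) ← cover (spans w a₁ ∈⊤ ∈⊤ w≢a₁)
        (B₂ , s₂ , w₂ , a₂′) ← cover (spans w a₂ ∈⊤ ∈⊤ w≢a₂)
        smallB ← glue-small-triangle s₁ s₂ smallA w₁ a₁′ w₂ a₂′ a₁∈A a₂∈A w≢a₁ w≢a₂ a₁≢a₂
        inj₂ (B₁ ∪ B₂ ∪ A , smallB , R⊆P∪Q∪R B₁ B₂ , w , p⊆p∪q (B₂ ∪ A) w₁ , w∉A)

      -- Iterated growth; the fuel k bounds the number of steps still needed.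
      grow : ∀ {a₁ a₂} → a₁ ≢ a₂ → ∀ k {A} → Small A → a₁ ∈ A → a₂ ∈ A → L ≤ ∣ A ∣ + k → Found
      grow a₁≢a₂ zero {A} (_ , ∣A∣<L) _ _ L≤∣A∣+0 =
        ⊥-elim (<-irrefl refl (<-≤-trans ∣A∣<L (subst (L ≤_) (+-identityʳ ∣ A ∣) L≤∣A∣+0)))
      grow a₁≢a₂ (suc k) {A} smallA a₁∈A a₂∈A L≤∣A∣+k+1 with extend smallA a₁∈A a₂∈A a₁≢a₂
      ... | inj₁ found = found
      ... | inj₂ (B , smallB , A⊂B) =
        grow a₁≢a₂ k smallB (proj₁ A⊂B a₁∈A) (proj₁ A⊂B a₂∈A)
          (≤-trans L≤∣A∣+k+1 (subst (_≤ ∣ B ∣ + k) (≡-sym (+-suc ∣ A ∣ k))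
            (+-mono-≤ (p⊂q⇒∣p∣<∣q∣ A⊂B) (≤-refl {k}))))

      window : ∀ {a₁ a₂} → a₁ ≢ a₂ → Found
      window {a₁} {a₂} a₁≢a₂ with cover (spans a₁ a₂ ∈⊤ ∈⊤ a₁≢a₂)
      ... | inj₁ found = found
      ... | inj₂ (A , smallA , a₁∈A , a₂∈A) = grow a₁≢a₂ L smallA a₁∈A a₂∈A (m≤n+m L ∣ A ∣)

lemma20 : (n : ℕ) (G : Graph n) → SpansKn G → (L : ℕ) → 1 ≤ L → L ≤ n →
    Σ (Subset n) (λ S → InternallySpanned G S × (L ≤ ∣ S ∣ × ∣ S ∣ ≤ 3 * L))
lemma20 zero G spans L 1≤L L≤0 with ≤-trans 1≤L L≤0
... | ()
lemma20 (suc zero) G spans L 1≤L L≤1 =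
  ⁅ fzero ⁆ , singleton-spanned G {fzero} , L≤1 , ≤-trans 1≤L (m≤m+n L (L + (L + 0)))
lemma20 (suc (suc n)) G spans L 1≤L L≤n =
  Window.window G L 1≤L spans L≤n {fzero} {fsuc fzero} (λ ())
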